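{- For integers $n, k, j$ and integers $A, B, C \geq 0$ define \[ \mathcal{C}(n,k,j) = \binom{n-1}{k}^A \binom{n+k}{k}^B \binom{j}{n}^C . \] Then for every prime $p$ and all integers $n, k, j \geq 0$, $r \geq 1$, \[ \mathcal{C}(n p^r, k, j) \equiv (-1)^{(k + \lfloor k/p \rfloor) A}\, \mathcal{C}(n p^{r-1}, \lfloor k/p \rfloor, \lfloor j/p \rfloor) \pmod{p^r}. \]
   Context: For an integer $a$ (possibly negative) and an integer $b \geq 0$, $\binom{a}{b} = \prod_{i=1}^{b} \frac{a - i + 1}{i}$; in particular $\binom{a}{b}=0$ when $0\le a<b$. $\lfloor x \rfloor$ denotes the largest integer not exceeding $x$. -}

module Defs where

open import Data.Nat as ℕ using (ℕ; zero; suc; _!)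
open import Data.Nat.Properties using (_!≢0)
open import Data.Integer as ℤ using (ℤ; +_; _-_; _*_; _^_; _/_; 1ℤ)

falling : ℤ → ℕ → ℤ
falling a zero    = 1ℤ
falling a (suc b) = falling a b * (a - + b)

-- Generalized binomial coefficient for integer a and b ≥ 0:
-- binom a b = ∏_{i=1}^{b} (a - i + 1)/i = falling a b / b!  (exact division).
binom : ℤ → ℕ → ℤ
binom a b = _/_ (falling a b) (+ (b !)) {{b !≢0}}

𝒞 : (A B C : ℕ) → (n k j : ℕ) → ℤ
𝒞 A B C n k j =
  (binom (+ n - 1ℤ) k ^ A) * (binom (+ (n ℕ.+ k)) k ^ B) * (binom (+ j) n ^ C)

module Submission where

-- Put N = n p^r and M = n p^(r-1), so that N = M p and p^r ∣ N, and q = ⌊k/p⌋.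
-- The theorem follows factor by factor from three congruences modulo p^r:
--   (1) binom(N-1,k) ≡ (-1)^(k+q) binom(M-1,q),
--   (2) binom(N+k,k) ≡ binom(M+q,q),
--   (3) binom(j,N)   ≡ binom(⌊j/p⌋,M).
-- (1) is the heart: in binom(N-1,k) = ∏_{i≤k} (N-i)/i every factor with p ∤ i is
-- ≡ -1, while the factors with i = tp equal (M-t)/t and multiply to binom(M-1,q).
-- Denominators divisible by p cannot be inverted modulo p^r, so (1) is proved
-- through an exact identity binom(N-1,k)·D = E·binom(M-1,q) with p ∤ D and
-- E ≡ (-1)^(k+q) D, maintained along k = qp + t, and by finally cancelling D.
-- (1) holds for every integer M with p^r ∣ Mp; applied to -M, upper negation
-- binom(-x-1,k) = (-1)^k binom(x+k,k) turns it into (2), and (3) follows from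
-- (2) by symmetry binom(N+d,N) = binom(N+d,d) (both sides vanish when j < N).

open import Defs
open import Data.Nat as ℕ using (ℕ; _≤_)
open import Data.Nat.Primality using (Prime; prime⇒nonZero)
open import Data.Integer as ℤ using (ℤ; +_; -1ℤ; _-_; _*_; _^_)
open import Data.Integer.Divisibility using (_∣_)

open import Data.Nat using (zero; suc; _!)
open import Data.Nat.Properties as ℕP using (_!≢0)
open import Data.Nat.Primality using (euclidsLemma; prime⇒nonTrivial)
import Data.Nat.DivMod as ℕD
import Data.Nat.Divisibility as ℕ∣
open import Data.Integer using (-[1+_]; 0ℤ; 1ℤ; _+_; -_; ∣_∣)
import Data.Integer.Properties as ℤP
import Data.Integer.DivMod as ℤD
import Data.Integer.Divisibility.Signed as S
open import Data.Integer.Tactic.RingSolver using (solve-∀)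
open import Relation.Binary.PropositionalEquality
open import Relation.Nullary using (¬_)
open import Data.Empty using (⊥-elim)
open import Data.Sum using (inj₁; inj₂)

infix 4 _≡_mod_

-- x ≡ y mod m means that m divides x - y.  It is a record rather than a
-- definition so that the modulus can be inferred from the type.
record _≡_mod_ (x y m : ℤ) : Set where
  constructor mk-mod
  field divides-difference : m S.∣ (x - y)
open _≡_mod_

≡⇒≡-mod : ∀ {m x y} → x ≡ y → x ≡ y mod m
≡⇒≡-mod {m} {x} refl = mk-mod (subst (m S.∣_) (sym (ℤP.+-inverseʳ x)) (S.divides 0ℤ refl))

mod-trans : ∀ {m x y z} → x ≡ y mod m → y ≡ z mod m → x ≡ z mod m
mod-trans {m} {x} {y} {z} (mk-mod m∣x-y) (mk-mod m∣y-z) =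
  mk-mod (subst (m S.∣_) (telescope x y z) (S.∣m∣n⇒∣m+n m∣x-y m∣y-z))
  where
  telescope : ∀ x y z → (x - y) + (y - z) ≡ x - z
  telescope = solve-∀

mod-* : ∀ {m x x' y y'} → x ≡ x' mod m → y ≡ y' mod m → x * y ≡ x' * y' mod m
mod-* {m} {x} {x'} {y} {y'} (mk-mod m∣x-x') (mk-mod m∣y-y') =
  mk-mod (subst (m S.∣_) (expand x x' y y') (S.∣m∣n⇒∣m+n (S.∣n⇒∣m*n x m∣y-y') (S.∣m⇒∣m*n y' m∣x-x')))
  where
  expand : ∀ x x' y y' → x * (y - y') + (x - x') * y' ≡ x * y - x' * y'
  expand = solve-∀

mod-^ : ∀ {m x y} n → x ≡ y mod m → x ^ n ≡ y ^ n mod m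
mod-^ zero    x≡y = ≡⇒≡-mod refl
mod-^ (suc n) x≡y = mod-* x≡y (mod-^ n x≡y)

ℤ-induction : ∀ {ℓ} (P : ℤ → Set ℓ) → P 0ℤ →
              (∀ a → P a → P (a + 1ℤ)) → (∀ a → P (a + 1ℤ) → P a) → ∀ a → P a
ℤ-induction P P0 up down (+ zero)       = P0
ℤ-induction P P0 up down (+ suc m)      =
  subst P (cong +_ (ℕP.+-comm m 1)) (up (+ m) (ℤ-induction P P0 up down (+ m)))
ℤ-induction P P0 up down -[1+ zero ]    = down -[1+ zero ] P0
ℤ-induction P P0 up down -[1+ suc m ]   = down -[1+ suc m ] (ℤ-induction P P0 up down -[1+ m ])

falling-suc-front : ∀ a b → falling (a + 1ℤ) (suc b) ≡ (a + 1ℤ) * falling a b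
falling-suc-front a zero    = base a
  where
  base : ∀ a → 1ℤ * (a + 1ℤ - + 0) ≡ (a + 1ℤ) * 1ℤ
  base = solve-∀
falling-suc-front a (suc b) = begin
  falling (a + 1ℤ) (suc b) * (a + 1ℤ - + suc b)  ≡⟨ cong (_* (a + 1ℤ - + suc b)) (falling-suc-front a b) ⟩
  (a + 1ℤ) * falling a b * (a + 1ℤ - (1ℤ + + b)) ≡⟨ regroup a (falling a b) (+ b) ⟩
  (a + 1ℤ) * (falling a b * (a - + b))           ∎
  where
  open ≡-Reasoning
  regroup : ∀ a f b → (a + 1ℤ) * f * (a + 1ℤ - (1ℤ + b)) ≡ (a + 1ℤ) * (f * (a - b))
  regroup = solve-∀

falling-pascal : ∀ a b → falling (a + 1ℤ) (suc b) ≡ falling a (suc b) + + suc b * falling a b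
falling-pascal a b = trans (falling-suc-front a b) (split-top a (falling a b) (+ b))
  where
  split-top : ∀ a f b → (a + 1ℤ) * f ≡ f * (a - b) + (1ℤ + b) * f
  split-top = solve-∀

falling-split : ∀ a b c → falling a (c ℕ.+ b) ≡ falling a b * falling (a - + b) c
falling-split a b zero    = sym (ℤP.*-identityʳ _)
falling-split a b (suc c) =
  trans (cong (_* (a - + (c ℕ.+ b))) (falling-split a b c)) (regroup (falling a b) (falling (a - + b) c) a (+ b) (+ c))
  where
  regroup : ∀ f g a b c → f * g * (a - (c + b)) ≡ f * (g * (a - b - c))
  regroup = solve-∀

-- falling j b contains the factor j - j = 0 once b > j.
falling-vanish : ∀ {j b} → j ℕ.< b → falling (+ j) b ≡ 0ℤ
falling-vanish {j} {b} j<b = begin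
  falling (+ j) b                                 ≡⟨ cong (falling (+ j)) (sym (ℕP.m∸n+n≡m j<b)) ⟩
  falling (+ j) (d ℕ.+ suc j)                     ≡⟨ falling-split (+ j) (suc j) d ⟩
  falling (+ j) j * (+ j - + j) * rest            ≡⟨ cong (λ z → falling (+ j) j * z * rest) (ℤP.+-inverseʳ (+ j)) ⟩
  falling (+ j) j * 0ℤ * rest                     ≡⟨ cong (_* rest) (ℤP.*-zeroʳ (falling (+ j) j)) ⟩
  0ℤ                                              ∎
  where
  open ≡-Reasoning
  d = b ℕ.∸ suc j
  rest = falling (+ j - + suc j) d

falling-diagonal : ∀ n → falling (+ n) n ≡ + (n !)
falling-diagonal zero    = refl
falling-diagonal (suc n) = begin
  falling (+ suc n) (suc n)    ≡⟨ cong (λ z → falling z (suc n)) (sym n+1≡suc) ⟩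
  falling (+ n + 1ℤ) (suc n)   ≡⟨ falling-suc-front (+ n) n ⟩
  (+ n + 1ℤ) * falling (+ n) n ≡⟨ cong₂ _*_ n+1≡suc (falling-diagonal n) ⟩
  + suc n * + (n !)            ≡⟨ sym (ℤP.pos-* (suc n) (n !)) ⟩
  + (suc n !)                  ∎
  where
  open ≡-Reasoning
  n+1≡suc : + n + 1ℤ ≡ + suc n
  n+1≡suc = cong +_ (ℕP.+-comm n 1)

falling-upper-negation : ∀ x k → falling (- + x - 1ℤ) k ≡ -1ℤ ^ k * falling (+ (x ℕ.+ k)) k
falling-upper-negation x zero    = refl
falling-upper-negation x (suc k) = begin
  falling a k * (a - + k)                        ≡⟨ cong (_* (a - + k)) (falling-upper-negation x k) ⟩
  -1ℤ ^ k * falling b k * (a - + k)              ≡⟨ regroup (-1ℤ ^ k) (falling b k) (+ x) (+ k) ⟩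
  -1ℤ * -1ℤ ^ k * ((b + 1ℤ) * falling b k)       ≡⟨ cong (-1ℤ * -1ℤ ^ k *_) (sym (falling-suc-front b k)) ⟩
  -1ℤ ^ suc k * falling (b + 1ℤ) (suc k)         ≡⟨ cong (λ z → -1ℤ ^ suc k * falling z (suc k)) b+1≡ ⟩
  -1ℤ ^ suc k * falling (+ (x ℕ.+ suc k)) (suc k) ∎
  where
  open ≡-Reasoning
  a = - + x - 1ℤ
  b = + (x ℕ.+ k)
  b+1≡ : b + 1ℤ ≡ + (x ℕ.+ suc k)
  b+1≡ = cong +_ (trans (ℕP.+-comm (x ℕ.+ k) 1) (sym (ℕP.+-suc x k)))
  regroup : ∀ s f x k → s * f * (- x - 1ℤ - k) ≡ -1ℤ * s * ((x + k + 1ℤ) * f)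
  regroup = solve-∀

!-∣-suc* : ∀ b f → + (b !) S.∣ f → + (suc b !) S.∣ + suc b * f
!-∣-suc* b f (S.divides q f≡q*b!) = S.divides q (begin
  + suc b * f              ≡⟨ cong (+ suc b *_) f≡q*b! ⟩
  + suc b * (q * + (b !))  ≡⟨ swap (+ suc b) q (+ (b !)) ⟩
  q * (+ suc b * + (b !))  ≡⟨ cong (q *_) (sym (ℤP.pos-* (suc b) (b !))) ⟩
  q * + (suc b !)          ∎)
  where
  open ≡-Reasoning
  swap : ∀ s q f → s * (q * f) ≡ q * (s * f)
  swap = solve-∀

-- b! divides falling a b for every integer a: by induction on b, and for
-- fixed b by ℤ-induction on a, Pascal's rule moving a up and down by one.
!-∣-falling : ∀ b a → + (b !) S.∣ falling a b
!-∣-falling zero    a = S.∣-refl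
!-∣-falling (suc b) = ℤ-induction P P0 up down
  where
  P : ℤ → Set
  P a = + (suc b !) S.∣ falling a (suc b)
  P0 : P 0ℤ
  P0 = subst (+ (suc b !) S.∣_) (sym (falling-vanish {0} {suc b} (ℕ.s≤s ℕ.z≤n))) (S.divides 0ℤ refl)
  step : ∀ a → + (suc b !) S.∣ + suc b * falling a b
  step a = !-∣-suc* b (falling a b) (!-∣-falling b a)
  up : ∀ a → P a → P (a + 1ℤ)
  up a Pa = subst (_ S.∣_) (sym (falling-pascal a b)) (S.∣m∣n⇒∣m+n Pa (step a))
  down : ∀ a → P (a + 1ℤ) → P a
  down a Pa+1 = S.∣m+n∣n⇒∣m (subst (_ S.∣_) (falling-pascal a b) Pa+1) (step a)

[x/d]*d≡x : ∀ x d .{{_ : ℕ.NonZero d}} → + d S.∣ x → (x ℤ./ + d) * + d ≡ x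
[x/d]*d≡x x d d∣x = begin
  q * + d          ≡⟨ sym (ℤP.+-identityˡ (q * + d)) ⟩
  + 0 + q * + d    ≡⟨ cong (λ z → + z + q * + d) (sym r≡0) ⟩
  + r + q * + d    ≡⟨ sym x≡r+q*d ⟩
  x                ∎
  where
  open ≡-Reasoning
  q = x ℤ./ + d
  r = x ℤ.% + d
  x≡r+q*d : x ≡ + r + q * + d
  x≡r+q*d = ℤD.a≡a%n+[a/n]*n x (+ d)
  cancel : ∀ r s → r + s - s ≡ r
  cancel = solve-∀
  x-q*d≡r : x - q * + d ≡ + r
  x-q*d≡r = trans (cong (_- q * + d) x≡r+q*d) (cancel (+ r) (q * + d))
  d∣r : d ℕ∣.∣ r
  d∣r = S.∣⇒∣ᵤ (subst (+ d S.∣_) x-q*d≡r (S.∣m∣n⇒∣m-n d∣x (S.∣n⇒∣m*n q S.∣-refl)))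
  r≡0 : r ≡ 0
  r≡0 = trans (sym (ℕD.m<n⇒m%n≡m (ℤD.n%d<d x (+ d)))) (ℕ∣.n∣m⇒m%n≡0 r d d∣r)

binom-*-! : ∀ a b → binom a b * + (b !) ≡ falling a b
binom-*-! a b = [x/d]*d≡x (falling a b) (b !) {{b !≢0}} (!-∣-falling b a)

binom-unique : ∀ a b x → x * + (b !) ≡ falling a b → binom a b ≡ x
binom-unique a b x x*b!≡ = ℤP.*-cancelʳ-≡ _ _ (+ (b !)) {{b !≢0}} (trans (binom-*-! a b) (sym x*b!≡))

binom-step : ∀ a b → binom a (suc b) * + suc b ≡ binom a b * (a - + b)
binom-step a b = ℤP.*-cancelʳ-≡ _ _ (+ (b !)) {{b !≢0}} (begin
  binom a (suc b) * + suc b * + (b !)   ≡⟨ ℤP.*-assoc (binom a (suc b)) (+ suc b) (+ (b !)) ⟩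
  binom a (suc b) * (+ suc b * + (b !)) ≡⟨ cong (binom a (suc b) *_) (sym (ℤP.pos-* (suc b) (b !))) ⟩
  binom a (suc b) * + (suc b !)         ≡⟨ binom-*-! a (suc b) ⟩
  falling a b * (a - + b)               ≡⟨ cong (_* (a - + b)) (sym (binom-*-! a b)) ⟩
  binom a b * + (b !) * (a - + b)       ≡⟨ swap (binom a b) (+ (b !)) (a - + b) ⟩
  binom a b * (a - + b) * + (b !)       ∎)
  where
  open ≡-Reasoning
  swap : ∀ u v w → u * v * w ≡ u * w * v
  swap = solve-∀

binom-factorials : ∀ x y → binom (+ (x ℕ.+ y)) y * + (y !) * + (x !) ≡ + ((x ℕ.+ y) !)
binom-factorials x y = begin
  binom a y * + (y !) * + (x !)   ≡⟨ cong₂ _*_ (binom-*-! a y) (sym (falling-diagonal x)) ⟩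
  falling a y * falling (+ x) x   ≡⟨ cong (λ z → falling a y * falling z x) (sym a-y≡x) ⟩
  falling a y * falling (a - + y) x ≡⟨ sym (falling-split a y x) ⟩
  falling a (x ℕ.+ y)             ≡⟨ falling-diagonal (x ℕ.+ y) ⟩
  + ((x ℕ.+ y) !)                 ∎
  where
  open ≡-Reasoning
  a = + (x ℕ.+ y)
  cancel : ∀ x y → x + y - y ≡ x
  cancel = solve-∀
  a-y≡x : a - + y ≡ + x
  a-y≡x = trans (cong (_- + y) (ℤP.pos-+ x y)) (cancel (+ x) (+ y))

-- Symmetry binom(x+y,x) = binom(x+y,y): both equal (x+y)!/(x! y!).
binom-symmetric : ∀ x y → binom (+ (x ℕ.+ y)) x ≡ binom (+ (x ℕ.+ y)) y
binom-symmetric x y =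
  ℤP.*-cancelʳ-≡ _ _ (+ (x !)) {{x !≢0}} (ℤP.*-cancelʳ-≡ _ _ (+ (y !)) {{y !≢0}} (begin
    binom a x * + (x !) * + (y !) ≡⟨ subst (λ s → binom (+ s) x * + (x !) * + (y !) ≡ + (s !))
                                            (ℕP.+-comm y x) (binom-factorials y x) ⟩
    + ((x ℕ.+ y) !)               ≡⟨ sym (binom-factorials x y) ⟩
    binom a y * + (y !) * + (x !) ≡⟨ swap (binom a y) (+ (y !)) (+ (x !)) ⟩
    binom a y * + (x !) * + (y !) ∎))
  where
  open ≡-Reasoning
  a = + (x ℕ.+ y)
  swap : ∀ u v w → u * v * w ≡ u * w * v
  swap = solve-∀

binom-vanish : ∀ {j b} → j ℕ.< b → binom (+ j) b ≡ 0ℤ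
binom-vanish {j} {b} j<b = binom-unique (+ j) b 0ℤ (trans (ℤP.*-zeroˡ (+ (b !))) (sym (falling-vanish j<b)))

binom-upper-negation : ∀ x k → binom (- + x - 1ℤ) k ≡ -1ℤ ^ k * binom (+ (x ℕ.+ k)) k
binom-upper-negation x k = binom-unique _ k _ (begin
  -1ℤ ^ k * binom b k * + (k !)   ≡⟨ ℤP.*-assoc (-1ℤ ^ k) (binom b k) (+ (k !)) ⟩
  -1ℤ ^ k * (binom b k * + (k !)) ≡⟨ cong (-1ℤ ^ k *_) (binom-*-! b k) ⟩
  -1ℤ ^ k * falling b k           ≡⟨ sym (falling-upper-negation x k) ⟩
  falling (- + x - 1ℤ) k          ∎)
  where
  open ≡-Reasoning
  b = + (x ℕ.+ k)

prime-power-cancel : ∀ {p} → Prime p → ∀ r d x → ¬ (p ℕ∣.∣ d) →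
                     p ℕ.^ r ℕ∣.∣ d ℕ.* x → p ℕ.^ r ℕ∣.∣ x
prime-power-cancel pp zero    d x p∤d _ = ℕ∣.1∣ x
prime-power-cancel {p} pp (suc r) d x p∤d pʳ⁺¹∣dx
  with euclidsLemma d x pp (ℕ∣.∣-trans (ℕ∣.m∣m*n (p ℕ.^ r)) pʳ⁺¹∣dx)
... | inj₁ p∣d = ⊥-elim (p∤d p∣d)
... | inj₂ (ℕ∣.divides y refl) =
  subst (ℕ∣._∣ (y ℕ.* p)) (ℕP.*-comm (p ℕ.^ r) p)
        (ℕ∣.*-monoˡ-∣ p (prime-power-cancel pp r d y p∤d pʳ∣dy))
  where
  instance
    p≢0 : ℕ.NonZero p
    p≢0 = prime⇒nonZero pp
  pʳ∣dy : p ℕ.^ r ℕ∣.∣ d ℕ.* y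
  pʳ∣dy = ℕ∣.*-cancelˡ-∣ p
    (subst (p ℕ.* p ℕ.^ r ℕ∣.∣_) (trans (sym (ℕP.*-assoc d y p)) (ℕP.*-comm (d ℕ.* y) p)) pʳ⁺¹∣dx)

prime-power-cancelℤ : ∀ {p} → Prime p → ∀ r D X → ¬ (p ℕ∣.∣ ∣ D ∣) →
                      + (p ℕ.^ r) S.∣ D * X → + (p ℕ.^ r) S.∣ X
prime-power-cancelℤ pp r D X p∤D pʳ∣DX =
  S.∣ᵤ⇒∣ (prime-power-cancel pp r ∣ D ∣ ∣ X ∣ p∤D (subst (_ ℕ∣.∣_) (ℤP.abs-* D X) (S.∣⇒∣ᵤ pʳ∣DX)))

±-involutive : ∀ k y → -1ℤ ^ k * (-1ℤ ^ k * y) ≡ y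
±-involutive zero    y = trans (ℤP.*-identityˡ _) (ℤP.*-identityˡ y)
±-involutive (suc k) y = trans (swap (-1ℤ ^ k) y) (±-involutive k y)
  where
  swap : ∀ s y → -1ℤ * s * (-1ℤ * s * y) ≡ s * (s * y)
  swap = solve-∀


module LucasCore (p : ℕ) (pp : Prime p) (r : ℕ) (M : ℤ) (pʳ∣Mp : + (p ℕ.^ r) S.∣ M * + p) where
  instance
    p≢0 : ℕ.NonZero p
    p≢0 = prime⇒nonZero pp

  pʳ : ℤ
  pʳ = + (p ℕ.^ r)

  N : ℤ
  N = M * + p

  sign : ℕ → ℕ → ℤ
  sign k q = -1ℤ ^ (k ℕ.+ q)

  -- An exact factorisation binom(N-1,k) · D = E · binom(M-1,q), where D collects
  -- the factors i ≤ k prime to p and E the matching numerators N - i ≡ -i.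
  record Factorisation (k q : ℕ) : Set where
    field
      D E      : ℤ
      identity : binom (N - 1ℤ) k * D ≡ E * binom (M - 1ℤ) q
      p∤D      : ¬ (p ℕ∣.∣ ∣ D ∣)
      E≡±D     : E ≡ sign k q * D mod pʳ

  -- Passing from k to k+1 with p ∤ k+1: the new factor (N-1-k)/(k+1) ≡ -1 is
  -- absorbed into D and E.
  extend-coprime : ∀ {k q} → Factorisation k q → ¬ (p ℕ∣.∣ suc k) → Factorisation (suc k) q
  extend-coprime {k} {q} F p∤k+1 = record
    { D = D * + suc k ; E = E * c ; identity = identity′ ; p∤D = p∤D′ ; E≡±D = E≡±D′ }
    where
    open Factorisation F
    open ≡-Reasoning
    c = N - 1ℤ - + k
    identity′ : binom (N - 1ℤ) (suc k) * (D * + suc k) ≡ E * c * binom (M - 1ℤ) q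
    identity′ = begin
      binom (N - 1ℤ) (suc k) * (D * + suc k) ≡⟨ regroup (binom (N - 1ℤ) (suc k)) D (+ suc k) ⟩
      binom (N - 1ℤ) (suc k) * + suc k * D   ≡⟨ cong (_* D) (binom-step (N - 1ℤ) k) ⟩
      binom (N - 1ℤ) k * c * D               ≡⟨ swap (binom (N - 1ℤ) k) c D ⟩
      binom (N - 1ℤ) k * D * c               ≡⟨ cong (_* c) identity ⟩
      E * binom (M - 1ℤ) q * c               ≡⟨ swap E (binom (M - 1ℤ) q) c ⟩
      E * c * binom (M - 1ℤ) q               ∎
      where
      regroup : ∀ b d s → b * (d * s) ≡ b * s * d
      regroup = solve-∀
      swap : ∀ u v w → u * v * w ≡ u * w * v
      swap = solve-∀
    p∤D′ : ¬ (p ℕ∣.∣ ∣ D * + suc k ∣)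
    p∤D′ p∣Dk with euclidsLemma ∣ D ∣ (suc k) pp (subst (p ℕ∣.∣_) (ℤP.abs-* D (+ suc k)) p∣Dk)
    ... | inj₁ p∣D   = p∤D p∣D
    ... | inj₂ p∣k+1 = p∤k+1 p∣k+1
    -- E c - (-s) D (k+1) = (E - s D) c + s D N, and p^r divides both summands.
    E≡±D′ : E * c ≡ sign (suc k) q * (D * + suc k) mod pʳ
    E≡±D′ = mk-mod (subst (pʳ S.∣_) (sym (expand E (M * + p) (+ k) (sign k q) D))
      (S.∣m∣n⇒∣m+n (S.∣m⇒∣m*n c (divides-difference E≡±D)) (S.∣n⇒∣m*n (sign k q * D) pʳ∣Mp)))
      where
      expand : ∀ E N k s D → E * (N - 1ℤ - k) - -1ℤ * s * (D * (1ℤ + k)) ≡ (E - s * D) * (N - 1ℤ - k) + s * D * N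
      expand = solve-∀

  -- Passing from k to k+1 = (q+1)p: the new factor (N-1-k)/(k+1) equals
  -- (M-1-q)/(q+1), the factor taking binom(M-1,q) to binom(M-1,q+1).
  extend-multiple : ∀ {k q} → Factorisation k q → suc k ≡ suc q ℕ.* p → Factorisation (suc k) (suc q)
  extend-multiple {k} {q} F k+1≡[q+1]p = record
    { D = D ; E = E ; identity = identity′ ; p∤D = p∤D
    ; E≡±D = subst (λ s → E ≡ s * D mod pʳ) (sym sign-shift) E≡±D }
    where
    open Factorisation F
    open ≡-Reasoning
    Q = + suc q
    P = + p
    k+1≡QP : 1ℤ + + k ≡ Q * P
    k+1≡QP = trans (cong +_ k+1≡[q+1]p) (ℤP.pos-* (suc q) p)
    sign-shift : sign (suc k) (suc q) ≡ sign k q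
    sign-shift = trans (cong (λ n → -1ℤ * -1ℤ ^ n) (ℕP.+-suc k q)) (-1*-1*s (sign k q))
      where
      -1*-1*s : ∀ s → -1ℤ * (-1ℤ * s) ≡ s
      -1*-1*s = solve-∀
    step-N : binom (N - 1ℤ) (suc k) * Q ≡ binom (N - 1ℤ) k * (M - Q)
    step-N = ℤP.*-cancelʳ-≡ _ _ P (begin
      binom (N - 1ℤ) (suc k) * Q * P         ≡⟨ ℤP.*-assoc (binom (N - 1ℤ) (suc k)) Q P ⟩
      binom (N - 1ℤ) (suc k) * (Q * P)       ≡⟨ cong (binom (N - 1ℤ) (suc k) *_) (sym k+1≡QP) ⟩
      binom (N - 1ℤ) (suc k) * (1ℤ + + k)    ≡⟨ binom-step (N - 1ℤ) k ⟩
      binom (N - 1ℤ) k * (M * P - 1ℤ - + k)  ≡⟨ cong (binom (N - 1ℤ) k *_) (rewrite-k (M * P) (+ k)) ⟩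
      binom (N - 1ℤ) k * (M * P - (1ℤ + + k)) ≡⟨ cong (λ z → binom (N - 1ℤ) k * (M * P - z)) k+1≡QP ⟩
      binom (N - 1ℤ) k * (M * P - Q * P)     ≡⟨ factor-P (binom (N - 1ℤ) k) M Q P ⟩
      binom (N - 1ℤ) k * (M - Q) * P         ∎)
      where
      rewrite-k : ∀ n k → n - 1ℤ - k ≡ n - (1ℤ + k)
      rewrite-k = solve-∀
      factor-P : ∀ b m q p → b * (m * p - q * p) ≡ b * (m - q) * p
      factor-P = solve-∀
    identity′ : binom (N - 1ℤ) (suc k) * D ≡ E * binom (M - 1ℤ) (suc q)
    identity′ = ℤP.*-cancelʳ-≡ _ _ Q (begin
      binom (N - 1ℤ) (suc k) * D * Q      ≡⟨ swap (binom (N - 1ℤ) (suc k)) D Q ⟩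
      binom (N - 1ℤ) (suc k) * Q * D      ≡⟨ cong (_* D) step-N ⟩
      binom (N - 1ℤ) k * (M - Q) * D      ≡⟨ swap (binom (N - 1ℤ) k) (M - Q) D ⟩
      binom (N - 1ℤ) k * D * (M - Q)      ≡⟨ cong (_* (M - Q)) identity ⟩
      E * binom (M - 1ℤ) q * (M - Q)      ≡⟨ regroup E (binom (M - 1ℤ) q) M (+ q) ⟩
      E * (binom (M - 1ℤ) q * (M - 1ℤ - + q)) ≡⟨ cong (E *_) (sym (binom-step (M - 1ℤ) q)) ⟩
      E * (binom (M - 1ℤ) (suc q) * Q)    ≡⟨ sym (ℤP.*-assoc E (binom (M - 1ℤ) (suc q)) Q) ⟩
      E * binom (M - 1ℤ) (suc q) * Q      ∎)
      where
      swap : ∀ u v w → u * v * w ≡ u * w * v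
      swap = solve-∀
      regroup : ∀ e b m q → e * b * (m - (1ℤ + q)) ≡ e * (b * (m - 1ℤ - q))
      regroup = solve-∀

  -- Factorisations exist for every k = qp + t with t < p, by induction on q
  -- and t: the steps k ↦ k+1 inside a block are coprime to p, the step
  -- closing a block lands on a multiple of p.
  factorisation : ∀ q t → t ℕ.< p → Factorisation (q ℕ.* p ℕ.+ t) q
  factorisation zero    zero    _   = record
    { D = 1ℤ ; E = 1ℤ ; identity = refl ; p∤D = p∤1 ; E≡±D = ≡⇒≡-mod refl }
    where
    p∤1 : ¬ (p ℕ∣.∣ 1)
    p∤1 p∣1 = ℕ.nonTrivial⇒≢1 {{prime⇒nonTrivial pp}} (ℕ∣.∣1⇒≡1 p∣1)
  factorisation q       (suc t) t+1<p =
    subst (λ k → Factorisation k q) (sym (ℕP.+-suc (q ℕ.* p) t))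
      (extend-coprime (factorisation q t (ℕP.<-trans (ℕP.n<1+n t) t+1<p)) p∤k+1)
    where
    p∤k+1 : ¬ (p ℕ∣.∣ suc (q ℕ.* p ℕ.+ t))
    p∤k+1 p∣k+1 = ℕP.<⇒≱ t+1<p (ℕ∣.∣⇒≤ (ℕ∣.∣m+n∣m⇒∣n
      (subst (p ℕ∣.∣_) (sym (ℕP.+-suc (q ℕ.* p) t)) p∣k+1) (ℕ∣.n∣m*n q)))
  factorisation (suc q) zero    _   =
    subst (λ k → Factorisation k (suc q)) (trans block-end (sym (ℕP.+-identityʳ (suc q ℕ.* p))))
      (extend-multiple (factorisation q (ℕ.pred p) pred-p<p) block-end)
    where
    pred-p<p : ℕ.pred p ℕ.< p
    pred-p<p = ℕP.≤-reflexive (ℕP.suc-pred p)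
    block-end : suc (q ℕ.* p ℕ.+ ℕ.pred p) ≡ suc q ℕ.* p
    block-end = begin
      suc (q ℕ.* p ℕ.+ ℕ.pred p)  ≡⟨ sym (ℕP.+-suc (q ℕ.* p) (ℕ.pred p)) ⟩
      q ℕ.* p ℕ.+ suc (ℕ.pred p)  ≡⟨ cong (q ℕ.* p ℕ.+_) (ℕP.suc-pred p) ⟩
      q ℕ.* p ℕ.+ p              ≡⟨ ℕP.+-comm (q ℕ.* p) p ⟩
      suc q ℕ.* p                ∎
      where open ≡-Reasoning

  -- From the factorisation, D · (binom(N-1,k) - s·binom(M-1,q)) = (E - s D) · binom(M-1,q)
  -- is divisible by p^r, and D can be cancelled since p ∤ D.
  binom-lucas : ∀ k → binom (N - 1ℤ) k ≡ sign k (k ℕ./ p) * binom (M - 1ℤ) (k ℕ./ p) mod pʳ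
  binom-lucas k = mk-mod (prime-power-cancelℤ pp r D _ p∤D
    (subst (pʳ S.∣_) (sym (factor-out D (binom (N - 1ℤ) k) (sign k q) (binom (M - 1ℤ) q) E identity))
      (S.∣m⇒∣m*n (binom (M - 1ℤ) q) (divides-difference E≡±D))))
    where
    q = k ℕ./ p
    k≡qp+t : q ℕ.* p ℕ.+ k ℕ.% p ≡ k
    k≡qp+t = trans (ℕP.+-comm (q ℕ.* p) (k ℕ.% p)) (sym (ℕD.m≡m%n+[m/n]*n k p))
    open Factorisation (subst (λ k → Factorisation k q) k≡qp+t (factorisation q (k ℕ.% p) (ℕD.m%n<n k p)))
    factor-out : ∀ D f s b E → f * D ≡ E * b → D * (f - s * b) ≡ (E - s * D) * b
    factor-out D f s b E fD≡Eb = trans (expand D f s b) (trans (cong (_- s * D * b) fD≡Eb) (collect E s D b))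
      where
      expand : ∀ D f s b → D * (f - s * b) ≡ f * D - s * D * b
      expand = solve-∀
      collect : ∀ E s D b → E * b - s * D * b ≡ (E - s * D) * b
      collect = solve-∀

module Factors (p : ℕ) (pp : Prime p) (r M N : ℕ) (N≡Mp : N ≡ M ℕ.* p) (pʳ∣N : p ℕ.^ r ℕ∣.∣ N) where
  instance
    p≢0 : ℕ.NonZero p
    p≢0 = prime⇒nonZero pp

  pʳ : ℤ
  pʳ = + (p ℕ.^ r)

  +N≡+M*p : + N ≡ + M * + p
  +N≡+M*p = trans (cong +_ N≡Mp) (ℤP.pos-* M p)

  pʳ∣Mp : pʳ S.∣ + M * + p
  pʳ∣Mp = subst (pʳ S.∣_) +N≡+M*p (S.∣ᵤ⇒∣ pʳ∣N)

  pʳ∣-Mp : pʳ S.∣ - + M * + p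
  pʳ∣-Mp = subst (pʳ S.∣_) (ℤP.neg-distribˡ-* (+ M) (+ p)) (S.∣m⇒∣-m pʳ∣Mp)

  module AtM  = LucasCore p pp r (+ M) pʳ∣Mp
  module At-M = LucasCore p pp r (- + M) pʳ∣-Mp

  first-factor : ∀ k → binom (+ N - 1ℤ) k ≡ -1ℤ ^ (k ℕ.+ k ℕ./ p) * binom (+ M - 1ℤ) (k ℕ./ p) mod pʳ
  first-factor k = subst (λ a → binom (a - 1ℤ) k ≡ AtM.sign k (k ℕ./ p) * binom (+ M - 1ℤ) (k ℕ./ p) mod pʳ)
                         (sym +N≡+M*p) (AtM.binom-lucas k)

  -- (2) binom(N+k,k) ≡ binom(M+q,q): the core congruence at -M, rewritten by
  -- upper negation on both sides; the signs (-1)^k, (-1)^(k+q), (-1)^q cancel.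
  second-factor : ∀ k → binom (+ (N ℕ.+ k)) k ≡ binom (+ (M ℕ.+ k ℕ./ p)) (k ℕ./ p) mod pʳ
  second-factor k =
    subst₂ (λ u v → u ≡ v mod pʳ) (±-involutive k (binom (+ (N ℕ.+ k)) k)) signs-cancel
           (mod-* (≡⇒≡-mod {x = -1ℤ ^ k} refl) negated)
    where
    q = k ℕ./ p
    Y = binom (+ (M ℕ.+ q)) q
    -M*p≡-N : - + M * + p ≡ - + N
    -M*p≡-N = trans (sym (ℤP.neg-distribˡ-* (+ M) (+ p))) (cong -_ (sym +N≡+M*p))
    negated : -1ℤ ^ k * binom (+ (N ℕ.+ k)) k ≡ -1ℤ ^ (k ℕ.+ q) * (-1ℤ ^ q * Y) mod pʳ
    negated = subst₂ (λ u v → u ≡ -1ℤ ^ (k ℕ.+ q) * v mod pʳ)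
      (trans (cong (λ a → binom (a - 1ℤ) k) -M*p≡-N) (binom-upper-negation N k))
      (binom-upper-negation M q) (At-M.binom-lucas k)
    signs-cancel : -1ℤ ^ k * (-1ℤ ^ (k ℕ.+ q) * (-1ℤ ^ q * Y)) ≡ Y
    signs-cancel = begin
      e * (-1ℤ ^ (k ℕ.+ q) * (f * Y)) ≡⟨ cong (λ z → e * (z * (f * Y))) (ℤP.^-distribˡ-+-* -1ℤ k q) ⟩
      e * (e * f * (f * Y))           ≡⟨ regroup e f Y ⟩
      e * (e * (f * (f * Y)))         ≡⟨ ±-involutive k (f * (f * Y)) ⟩
      f * (f * Y)                     ≡⟨ ±-involutive q Y ⟩
      Y                               ∎
      where
      open ≡-Reasoning
      e = -1ℤ ^ k
      f = -1ℤ ^ q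
      regroup : ∀ e f y → e * (e * f * (f * y)) ≡ e * (e * (f * (f * y)))
      regroup = solve-∀

  -- (3) binom(j,N) ≡ binom(⌊j/p⌋,M): both vanish if j < N; otherwise j = N + d,
  -- ⌊j/p⌋ = M + ⌊d/p⌋, and symmetry reduces to (2) at d.
  third-factor : ∀ j → binom (+ j) N ≡ binom (+ (j ℕ./ p)) M mod pʳ
  third-factor j with ℕP.<-≤-connex j N
  ... | inj₁ j<N = ≡⇒≡-mod (trans (binom-vanish j<N) (sym (binom-vanish j/p<M)))
    where
    j/p<M : j ℕ./ p ℕ.< M
    j/p<M = ℕD.m<n*o⇒m/o<n (subst (j ℕ.<_) N≡Mp j<N)
  ... | inj₂ N≤j = subst₂ (λ u v → binom (+ u) N ≡ binom (+ v) M mod pʳ) N+d≡j M+d/p≡j/p shifted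
    where
    d = j ℕ.∸ N
    N+d≡j : N ℕ.+ d ≡ j
    N+d≡j = ℕP.m+[n∸m]≡n N≤j
    M+d/p≡j/p : M ℕ.+ d ℕ./ p ≡ j ℕ./ p
    M+d/p≡j/p = begin
      M ℕ.+ d ℕ./ p                 ≡⟨ cong (ℕ._+ d ℕ./ p) (sym (ℕD.m*n/n≡m M p)) ⟩
      M ℕ.* p ℕ./ p ℕ.+ d ℕ./ p     ≡⟨ sym (ℕD.+-distrib-/-∣ˡ d (ℕ∣.n∣m*n M)) ⟩
      (M ℕ.* p ℕ.+ d) ℕ./ p         ≡⟨ cong (λ n → (n ℕ.+ d) ℕ./ p) (sym N≡Mp) ⟩
      (N ℕ.+ d) ℕ./ p               ≡⟨ cong (ℕ._/ p) N+d≡j ⟩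
      j ℕ./ p                       ∎
      where open ≡-Reasoning
    shifted : binom (+ (N ℕ.+ d)) N ≡ binom (+ (M ℕ.+ d ℕ./ p)) M mod pʳ
    shifted = subst₂ (λ u v → u ≡ v mod pʳ) (sym (binom-symmetric N d)) (sym (binom-symmetric M (d ℕ./ p)))
                     (second-factor d)

^-distribʳ-* : ∀ x y n → (x * y) ^ n ≡ x ^ n * y ^ n
^-distribʳ-* x y zero    = refl
^-distribʳ-* x y (suc n) = trans (cong (x * y *_) (^-distribʳ-* x y n)) (swap x y (x ^ n) (y ^ n))
  where
  swap : ∀ x y u v → x * y * (u * v) ≡ x * u * (y * v)
  swap = solve-∀

sign-out : ∀ e x y z A B C →
           (-1ℤ ^ e * x) ^ A * y ^ B * z ^ C ≡ -1ℤ ^ (e ℕ.* A) * (x ^ A * y ^ B * z ^ C)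
sign-out e x y z A B C = begin
  (-1ℤ ^ e * x) ^ A * y ^ B * z ^ C           ≡⟨ cong (λ u → u * y ^ B * z ^ C) (^-distribʳ-* (-1ℤ ^ e) x A) ⟩
  (-1ℤ ^ e) ^ A * x ^ A * y ^ B * z ^ C       ≡⟨ cong (λ s → s * x ^ A * y ^ B * z ^ C) (ℤP.^-*-assoc -1ℤ e A) ⟩
  -1ℤ ^ (e ℕ.* A) * x ^ A * y ^ B * z ^ C     ≡⟨ regroup (-1ℤ ^ (e ℕ.* A)) (x ^ A) (y ^ B) (z ^ C) ⟩
  -1ℤ ^ (e ℕ.* A) * (x ^ A * y ^ B * z ^ C)   ∎
  where
  open ≡-Reasoning
  regroup : ∀ s a b c → s * a * b * c ≡ s * (a * b * c)
  regroup = solve-∀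

lemma2p5 : (A B C p : ℕ) → (pp : Prime p) → (n k j r : ℕ) → 1 ≤ r →
    (+ (p ℕ.^ r)) ∣
      (𝒞 A B C (n ℕ.* p ℕ.^ r) k j
        - (-1ℤ ^ ((k ℕ.+ ℕ._/_ k p {{prime⇒nonZero pp}}) ℕ.* A))
          * 𝒞 A B C (n ℕ.* p ℕ.^ (r ℕ.∸ 1)) (ℕ._/_ k p {{prime⇒nonZero pp}}) (ℕ._/_ j p {{prime⇒nonZero pp}}))
lemma2p5 A B C p pp n k j (suc r) _ = S.∣⇒∣ᵤ (divides-difference (mod-trans factorwise (≡⇒≡-mod signs)))
  where
  M = n ℕ.* p ℕ.^ r
  N = n ℕ.* p ℕ.^ suc r
  N≡Mp : N ≡ M ℕ.* p
  N≡Mp = trans (cong (n ℕ.*_) (ℕP.*-comm p (p ℕ.^ r))) (sym (ℕP.*-assoc n (p ℕ.^ r) p))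
  open Factors p pp (suc r) M N N≡Mp (ℕ∣.n∣m*n n)
  q = k ℕ./ p
  factorwise : 𝒞 A B C N k j ≡ (-1ℤ ^ (k ℕ.+ q) * binom (+ M - 1ℤ) q) ^ A
                                 * binom (+ (M ℕ.+ q)) q ^ B * binom (+ (j ℕ./ p)) M ^ C mod pʳ
  factorwise = mod-* (mod-* (mod-^ A (first-factor k)) (mod-^ B (second-factor k))) (mod-^ C (third-factor j))
  signs : (-1ℤ ^ (k ℕ.+ q) * binom (+ M - 1ℤ) q) ^ A * binom (+ (M ℕ.+ q)) q ^ B * binom (+ (j ℕ./ p)) M ^ C
          ≡ -1ℤ ^ ((k ℕ.+ q) ℕ.* A) * 𝒞 A B C M q (j ℕ./ p)
  signs = sign-out (k ℕ.+ q) (binom (+ M - 1ℤ) q) (binom (+ (M ℕ.+ q)) q) (binom (+ (j ℕ./ p)) M) A B C
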